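{- Let $A=\begin{pmatrix}2&-b\\-a&2\end{pmatrix}$ with integers $a,b\ge2$ and $ab\ge5$. Then the Kac--Moody root system associated to $A$ has the following property: every nontrivial $w\in W$ can be written as $w=v\,w_\beta$, where $\beta$ is a simple root, $\ell(v)<\ell(w)$, and $\alpha-\beta$ is not a real root for any $\alpha\in\Phi_v$.
   Context: For the Kac--Moody algebra $\mathfrak g(A)$: simple roots $\alpha_1,\alpha_2$, coroots $\alpha_1^\vee,\alpha_2^\vee$ with $\langle\alpha_j,\alpha_i^\vee\rangle=a_{ij}$ (entries of $A$), roots $\Phi=\Phi_+\sqcup\Phi_-$, Weyl group $W$ generated by the simple reflections $w_1,w_2$ (also written $w_\beta$ for a simple root $\beta$), length function $\ell$, and $\Phi_v=\Phi_+\cap v^{ -1}\Phi_-$. A root is real if it is $W$-conjugate to a simple root. -}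

module Defs where

open import Data.Nat using (ℕ; _<_)
open import Data.Integer using (ℤ; +_; -_; _+_; _-_; _*_; _≤_; 0ℤ; 1ℤ)
open import Data.Fin using (Fin; zero; suc)
open import Data.List using (List; []; _∷_; length)
open import Data.Product using (_×_; _,_; Σ; ∃; ∃-syntax)
open import Data.Sum using (_⊎_)
open import Relation.Nullary using (¬_)
open import Relation.Binary.PropositionalEquality using (_≡_)

-- Generalized Cartan matrix A = ( 2  -b ; -a  2 ), indices 0,1 standing for 1,2.
-- cartan a b i j = a_{ij} = ⟨α_j , α_i^∨⟩.
cartan : ℕ → ℕ → Fin 2 → Fin 2 → ℤ
cartan a b zero zero = + 2
cartan a b zero (suc zero) = - (+ b)
cartan a b (suc zero) zero = - (+ a)
cartan a b (suc zero) (suc zero) = + 2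

-- Root lattice Q = ℤα₁ ⊕ ℤα₂; (x , y) stands for x α₁ + y α₂.
Lat : Set
Lat = ℤ × ℤ

coeff : Lat → Fin 2 → ℤ
coeff (x , y) zero = x
coeff (x , y) (suc zero) = y

simple : Fin 2 → Lat
simple zero = (1ℤ , 0ℤ)
simple (suc zero) = (0ℤ , 1ℤ)

_⊕_ : Lat → Lat → Lat
(x , y) ⊕ (x' , y') = (x + x' , y + y')

_⊖_ : Lat → Lat → Lat
(x , y) ⊖ (x' , y') = (x - x' , y - y')

neg : Lat → Lat
neg (x , y) = (- x , - y)

scale : ℤ → Lat → Lat
scale c (x , y) = (c * x , c * y)

pair : ℕ → ℕ → Lat → Fin 2 → ℤ
pair a b γ i = coeff γ zero * cartan a b i zero + coeff γ (suc zero) * cartan a b i (suc zero)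

refl : ℕ → ℕ → Fin 2 → Lat → Lat
refl a b i γ = γ ⊖ scale (pair a b γ i) (simple i)

-- Elements of W are represented by words in the simple reflections;
-- the word i₁ ∷ i₂ ∷ … ∷ iₖ ∷ [] represents w_{i₁} w_{i₂} ⋯ w_{iₖ}.
Word : Set
Word = List (Fin 2)

act : ℕ → ℕ → Word → Lat → Lat
act a b [] γ = γ
act a b (i ∷ u) γ = refl a b i (act a b u γ)

-- Equality in W: equality of the induced linear maps on h* = Q ⊗ ℂ
-- (det A = 4 - ab ≠ 0, so the simple roots form a basis of h*).
_≈W[_,_]_ : Word → ℕ → ℕ → Word → Set
u ≈W[ a , b ] u' = ∀ γ → act a b u γ ≡ act a b u' γ

LengthLess : ℕ → ℕ → Word → Word → Set
LengthLess a b v w =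
  Σ Word λ v' → (v' ≈W[ a , b ] v) × (∀ w' → w' ≈W[ a , b ] w → length v' < length w')

Positive : Lat → Set
Positive (x , y) = (0ℤ ≤ x) × (0ℤ ≤ y) × ¬ ((x , y) ≡ (0ℤ , 0ℤ))

Negative : Lat → Set
Negative γ = Positive (neg γ)

RealRoot : ℕ → ℕ → Lat → Set
RealRoot a b γ = Σ Word λ u → Σ (Fin 2) λ i → act a b u (simple i) ≡ γ

-- Kac's fundamental set K = { κ ∈ Q₊\{0} : supp κ connected, ⟨κ,α_i^∨⟩ ≤ 0 ∀ i }.
-- (For a,b ≥ 1 the Dynkin diagram is connected, so every support is connected.)
FundamentalSet : ℕ → ℕ → Lat → Set
FundamentalSet a b κ = Positive κ × (∀ i → pair a b κ i ≤ 0ℤ)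

-- imaginary roots: Φ^im = W K ∪ - W K  (Kac, Thm 5.4)
ImagRoot : ℕ → ℕ → Lat → Set
ImagRoot a b γ =
  Σ Word λ u → Σ Lat λ κ → FundamentalSet a b κ × ((act a b u κ ≡ γ) ⊎ (neg (act a b u κ) ≡ γ))

Root : ℕ → ℕ → Lat → Set
Root a b γ = RealRoot a b γ ⊎ ImagRoot a b γ

InvSet : ℕ → ℕ → Word → Lat → Set
InvSet a b v α = Root a b α × Positive α × Root a b (act a b v α) × Negative (act a b v α)

module Submission where

-- Every element of W is represented by an alternating word alt i n (the
-- normal form obtained by cancelling repeated letters), and alternating
-- words are reduced: alt j (suc m) sends the simple root of its last letter
-- to a negative vector, whereas shorter alternating words keep it in a
-- positive cone { γ ≥ 0 : ⟨γ , α_i^∨⟩ ≥ 1 } which the simple reflections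
-- move into each other (cone-step; this is where ab ≥ 4 is used).  For
-- w = alt i (suc k) take v = alt i k and β the letter after it.  Every
-- positive α inverted by v is steep: ⟨α , α_β'^∨⟩ ≥ 1 for the index β' ≠ β
-- and Q α ≥ 1, Q being the W-invariant quadratic form (steep-step, applied
-- along v).  For steep α the norm Q (α - α_β) exceeds both Q α₁ = a and
-- Q α₂ = b (steep-gap), whereas real roots have norm a or b.

open import Defs hiding (refl)
open import Data.Nat as ℕ using (ℕ; zero; suc; z≤n; s≤s)
import Data.Nat.Properties as ℕP
open import Data.Integer using (ℤ; +_; -[1+_]; -_; _+_; _-_; _*_; _≤_; _≤?_; 0ℤ; 1ℤ; +≤+)
import Data.Integer.Properties as ℤP
open import Data.Integer.Tactic.RingSolver using (solve; solve-∀)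
open import Data.Fin using (Fin; zero; suc)
open import Data.List using ([]; _∷_; _++_; length)
open import Data.Product using (Σ; _×_; _,_; proj₁; proj₂; uncurry)
open import Data.Sum using (_⊎_; inj₁; inj₂)
open import Data.Empty using (⊥-elim)
open import Relation.Nullary using (¬_; yes; no)
open import Function using (_$_)
open import Relation.Binary.PropositionalEquality
  using (_≡_; refl; sym; trans; cong; cong₂; subst; module ≡-Reasoning)

-- Every inequality below is proved by
-- an identity (checked by the ring solver) writing the quantity as a sum of
-- products of quantities already known to be nonnegative.

NonNeg : ℤ → Set
NonNeg t = 0ℤ ≤ t

-- t ≥ 1, in the subtractive form in which the certificates produce it
AtLeast1 : ℤ → Set
AtLeast1 t = NonNeg (t - 1ℤ)

nonNeg-ℕ : ∀ n → NonNeg (+ n)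
nonNeg-ℕ n = +≤+ z≤n

-- sums and products of nonnegative integers, written to mirror the
-- right-hand side of the certifying identity
infixl 6 _⟨+⟩_
infixl 7 _⟨*⟩_

_⟨+⟩_ : ∀ {p q} → NonNeg p → NonNeg q → NonNeg (p + q)
_⟨+⟩_ = ℤP.+-mono-≤

_⟨*⟩_ : ∀ {p q} → NonNeg p → NonNeg q → NonNeg (p * q)
_⟨*⟩_ {+ m} {+ n} _ _ = subst NonNeg (ℤP.pos-* m n) (nonNeg-ℕ (m ℕ.* n))

nonNeg-≡ : ∀ {s t} → s ≡ t → NonNeg t → NonNeg s
nonNeg-≡ e = subst NonNeg (sym e)

¬nonNeg-1 : ¬ NonNeg (- 1ℤ)
¬nonNeg-1 ()

¬atLeast1-self : ∀ k → ¬ AtLeast1 (k - k)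
¬atLeast1-self k h = ¬nonNeg-1 (subst NonNeg (cancel k) h)
  where
  cancel : ∀ k → k - k - 1ℤ ≡ - 1ℤ
  cancel = solve-∀

atLeast1-cancel : ∀ C t → AtLeast1 C → AtLeast1 (C * t) → AtLeast1 t
atLeast1-cancel (+ suc m) (+ suc n) _ _ = nonNeg-ℕ n
atLeast1-cancel (+ suc m) (+ zero) _ h =
  ⊥-elim (¬nonNeg-1 (subst AtLeast1 (ℤP.*-zeroʳ (+ suc m)) h))
atLeast1-cancel (+ suc m) -[1+ n ] _ ()
atLeast1-cancel (+ zero) t ()
atLeast1-cancel -[1+ m ] t ()

below-zero : ∀ t → ¬ NonNeg t → AtLeast1 (- t)
below-zero (+ n) t≱0 = ⊥-elim (t≱0 (nonNeg-ℕ n))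
below-zero -[1+ n ] _ = nonNeg-ℕ n

nonNeg-antisym : ∀ x → NonNeg x → NonNeg (- x) → x ≡ 0ℤ
nonNeg-antisym (+ zero) _ _ = refl
nonNeg-antisym (+ suc n) _ ()
nonNeg-antisym -[1+ n ] () _

atLeast2⇒atLeast1 : ∀ k → NonNeg (k - + 2) → AtLeast1 k
atLeast2⇒atLeast1 k h = nonNeg-≡ (shift k) (h ⟨+⟩ nonNeg-ℕ 1)
  where
  shift : ∀ k → k - 1ℤ ≡ (k - + 2) + 1ℤ
  shift = solve-∀

atLeast2⇒nonNeg : ∀ k → NonNeg (k - + 2) → NonNeg k
atLeast2⇒nonNeg k h = nonNeg-≡ (shift k) (h ⟨+⟩ nonNeg-ℕ 2)
  where
  shift : ∀ k → k ≡ (k - + 2) + + 2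
  shift = solve-∀

nonNeg-from-ℕ : ∀ a → 2 ℕ.≤ a → NonNeg (+ a - + 2)
nonNeg-from-ℕ (suc (suc k)) (s≤s (s≤s z≤n)) = nonNeg-ℕ k

origin : Lat
origin = (0ℤ , 0ℤ)

neg-involutive : ∀ γ → neg (neg γ) ≡ γ
neg-involutive (x , y) = cong₂ _,_ (ℤP.neg-involutive x) (ℤP.neg-involutive y)

positive⇒negative-neg : ∀ γ → Positive γ → Negative (neg γ)
positive⇒negative-neg γ = subst Positive (sym (neg-involutive γ))

positive-not-negative : ∀ γ → Positive γ → ¬ Negative γ
positive-not-negative (x , y) (x≥0 , y≥0 , γ≢0) (-x≥0 , -y≥0 , _)
  with nonNeg-antisym x x≥0 -x≥0 | nonNeg-antisym y y≥0 -y≥0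
... | refl | refl = γ≢0 refl

other : Fin 2 → Fin 2
other zero = suc zero
other (suc zero) = zero

other-involutive : ∀ i → other (other i) ≡ i
other-involutive zero = refl
other-involutive (suc zero) = refl

same-or-other : ∀ i j → i ≡ j ⊎ j ≡ other i
same-or-other zero zero = inj₁ refl
same-or-other zero (suc zero) = inj₂ refl
same-or-other (suc zero) zero = inj₂ refl
same-or-other (suc zero) (suc zero) = inj₁ refl

-- Alternating words.  alt j n is the word j (other j) j … of length n, and
-- letter j n is its (n+1)-st letter, i.e. the letter appended by alt j (suc n).

alt : Fin 2 → ℕ → Word
alt j zero = []
alt j (suc n) = j ∷ alt (other j) n

letter : Fin 2 → ℕ → Fin 2
letter j zero = j
letter j (suc n) = letter (other j) n

letter-other : ∀ n j → letter (other j) n ≡ other (letter j n)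
letter-other zero j = refl
letter-other (suc n) j = letter-other n (other j)

other-letter-suc : ∀ j n → other (letter j (suc n)) ≡ letter j n
other-letter-suc j n = trans (cong other (letter-other n j)) (other-involutive (letter j n))

alt-snoc : ∀ j n → alt j (suc n) ≡ alt j n ++ letter j n ∷ []
alt-snoc j zero = refl
alt-snoc j (suc n) = cong (j ∷_) (alt-snoc (other j) n)

length-alt : ∀ j n → length (alt j n) ≡ n
length-alt j zero = refl
length-alt j (suc n) = cong suc (length-alt (other j) n)

-- Normal form of a word in the free product of two groups of order 2: the
-- alternating word (first letter, length) obtained by cancelling adjacent
-- equal letters.

prepend : Fin 2 → Fin 2 × ℕ → Fin 2 × ℕ
prepend j (i , zero) = (j , 1)
prepend zero (zero , suc m) = (suc zero , m)
prepend zero (suc zero , suc m) = (zero , suc (suc m))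
prepend (suc zero) (zero , suc m) = (suc zero , suc (suc m))
prepend (suc zero) (suc zero , suc m) = (zero , m)

normal : Word → Fin 2 × ℕ
normal [] = (zero , 0)
normal (j ∷ u) = prepend j (normal u)

prepend-length : ∀ j p → proj₂ (prepend j p) ℕ.≤ suc (proj₂ p)
prepend-length j (i , zero) = ℕP.≤-refl
prepend-length zero (zero , suc m) = ℕP.m≤n+m m 2
prepend-length zero (suc zero , suc m) = ℕP.≤-refl
prepend-length (suc zero) (zero , suc m) = ℕP.≤-refl
prepend-length (suc zero) (suc zero , suc m) = ℕP.m≤n+m m 2

normal-length : ∀ w → proj₂ (normal w) ℕ.≤ length w
normal-length [] = z≤n
normal-length (j ∷ u) = ℕP.≤-trans (prepend-length j (normal u)) (s≤s (normal-length u))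

reflect-twice : ∀ k t u → k * t - (k * t - u) ≡ u
reflect-twice = solve-∀

reflect-neg : ∀ k t u → k * (- t) - (- u) ≡ - (k * t - u)
reflect-neg = solve-∀

reflect-origin : ∀ k → k * 0ℤ - 0ℤ ≡ 0ℤ
reflect-origin = solve-∀

reflect-simple : ∀ k → k * 0ℤ - 1ℤ ≡ - 1ℤ
reflect-simple = solve-∀

simple-pairing : ∀ k → + 2 * 1ℤ - k * 0ℤ - 1ℤ ≡ 1ℤ
simple-pairing = solve-∀

origin-pairing : ∀ k → + 2 * 0ℤ - k * 0ℤ - 1ℤ ≡ - 1ℤ
origin-pairing = solve-∀

module Rank2 (A B : ℤ) where

  s : Fin 2 → Lat → Lat
  s zero (x , y) = (B * y - x , y)
  s (suc zero) (x , y) = (x , A * x - y)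

  pairing : Fin 2 → Lat → ℤ
  pairing zero (x , y) = + 2 * x - B * y
  pairing (suc zero) (x , y) = + 2 * y - A * x

  -- the W-invariant quadratic form with Q α₁ = A and Q α₂ = B
  -- (half the invariant bilinear form with (α₁|α₁) = 2A, (α₂|α₂) = 2B)
  Q : Lat → ℤ
  Q (x , y) = A * x * x - A * B * x * y + B * y * y

  s-involutive : ∀ i γ → s i (s i γ) ≡ γ
  s-involutive zero (x , y) = cong (_, y) (reflect-twice B y x)
  s-involutive (suc zero) (x , y) = cong (x ,_) (reflect-twice A x y)

  s-neg : ∀ i γ → s i (neg γ) ≡ neg (s i γ)
  s-neg zero (x , y) = cong (_, - y) (reflect-neg B y x)
  s-neg (suc zero) (x , y) = cong (- x ,_) (reflect-neg A x y)

  s-origin : ∀ i → s i origin ≡ origin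
  s-origin zero = cong (_, 0ℤ) (reflect-origin B)
  s-origin (suc zero) = cong (0ℤ ,_) (reflect-origin A)

  s-simple : ∀ i → s i (simple i) ≡ neg (simple i)
  s-simple zero = cong (_, 0ℤ) (reflect-simple B)
  s-simple (suc zero) = cong (0ℤ ,_) (reflect-simple A)

  s-nonzero : ∀ i γ → ¬ γ ≡ origin → ¬ s i γ ≡ origin
  s-nonzero i γ γ≢0 sγ≡0 = γ≢0 (begin
    γ             ≡⟨ sym (s-involutive i γ) ⟩
    s i (s i γ)   ≡⟨ cong (s i) sγ≡0 ⟩
    s i origin    ≡⟨ s-origin i ⟩
    origin        ∎)
    where open ≡-Reasoning

  Q-invariant : ∀ i γ → Q (s i γ) ≡ Q γ
  Q-invariant zero (x , y) = expand
    where
    expand : A * (B * y - x) * (B * y - x) - A * B * (B * y - x) * y + B * y * y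
           ≡ A * x * x - A * B * x * y + B * y * y
    expand = solve (A ∷ B ∷ x ∷ y ∷ [])
  Q-invariant (suc zero) (x , y) = expand
    where
    expand : A * x * x - A * B * x * (A * x - y) + B * (A * x - y) * (A * x - y)
           ≡ A * x * x - A * B * x * y + B * y * y
    expand = solve (A ∷ B ∷ x ∷ y ∷ [])

  Q-simple : ∀ i → Q (simple i) ≡ A ⊎ Q (simple i) ≡ B
  Q-simple zero = inj₁ expand
    where
    expand : A * 1ℤ * 1ℤ - A * B * 1ℤ * 0ℤ + B * 0ℤ * 0ℤ ≡ A
    expand = solve (A ∷ B ∷ [])
  Q-simple (suc zero) = inj₂ expand
    where
    expand : A * 0ℤ * 0ℤ - A * B * 0ℤ * 1ℤ + B * 1ℤ * 1ℤ ≡ B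
    expand = solve (A ∷ B ∷ [])

  norm-gap : ∀ δ → AtLeast1 (Q δ - A) → AtLeast1 (Q δ - B) → ¬ (Q δ ≡ A ⊎ Q δ ≡ B)
  norm-gap δ h _ (inj₁ Qδ≡A) = ¬atLeast1-self A (subst (λ n → AtLeast1 (n - A)) Qδ≡A h)
  norm-gap δ _ h (inj₂ Qδ≡B) = ¬atLeast1-self B (subst (λ n → AtLeast1 (n - B)) Qδ≡B h)

  -- γ lies in the nonnegative cone and ⟨γ , α_i^∨⟩ ≥ 1; the images of a
  -- simple root under an alternating word stay in such a cone
  Cone : Fin 2 → Lat → Set
  Cone i (x , y) = NonNeg x × NonNeg y × AtLeast1 (pairing i (x , y))

  -- ⟨α , α_e^∨⟩ ≥ 1 and Q α ≥ 1; a positive α made negative by an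
  -- alternating word is steep for the index other than the letter after it
  Steep : Fin 2 → Lat → Set
  Steep e α = AtLeast1 (pairing e α) × AtLeast1 (Q α)

  cone-simple : ∀ i → Cone i (simple i)
  cone-simple zero = nonNeg-ℕ 1 , nonNeg-ℕ 0 , nonNeg-≡ (simple-pairing B) (nonNeg-ℕ 1)
  cone-simple (suc zero) = nonNeg-ℕ 0 , nonNeg-ℕ 1 , nonNeg-≡ (simple-pairing A) (nonNeg-ℕ 1)

  cone-positive : ∀ i γ → Cone i γ → Positive γ
  cone-positive zero (x , y) (x≥0 , y≥0 , h) =
    x≥0 , y≥0 , λ { refl → ¬nonNeg-1 (subst NonNeg (origin-pairing B) h) }
  cone-positive (suc zero) (x , y) (x≥0 , y≥0 , h) =
    x≥0 , y≥0 , λ { refl → ¬nonNeg-1 (subst NonNeg (origin-pairing A) h) }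

  module Bounds (A≥2 : NonNeg (A - + 2)) (B≥2 : NonNeg (B - + 2)) where

    A≥0 : NonNeg A
    A≥0 = atLeast2⇒nonNeg A A≥2

    B≥0 : NonNeg B
    B≥0 = atLeast2⇒nonNeg B B≥2

    A≥1 : AtLeast1 A
    A≥1 = atLeast2⇒atLeast1 A A≥2

    B≥1 : AtLeast1 B
    B≥1 = atLeast2⇒atLeast1 B B≥2

    AB≥4 : NonNeg (A * B - + 4)
    AB≥4 = nonNeg-≡ expand (A≥2 ⟨*⟩ B≥2 ⟨+⟩ nonNeg-ℕ 2 ⟨*⟩ A≥2 ⟨+⟩ nonNeg-ℕ 2 ⟨*⟩ B≥2)
      where
      expand : A * B - + 4 ≡ (A - + 2) * (B - + 2) + + 2 * (A - + 2) + + 2 * (B - + 2)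
      expand = solve (A ∷ B ∷ [])

    cone-step : ∀ i γ → Cone (other i) γ → Cone i (s i γ)
    cone-step zero (x , y) (x≥0 , y≥0 , h) = nonNeg-≡ moved (t≥1 ⟨+⟩ x≥0 ⟨+⟩ nonNeg-ℕ 1) , y≥0 , t≥1
      where
      certificate : A * (+ 2 * (B * y - x) - B * y) - 1ℤ
                  ≡ + 2 * (+ 2 * y - A * x - 1ℤ) + (A * B - + 4) * y + 1ℤ
      certificate = solve (A ∷ B ∷ x ∷ y ∷ [])
      t≥1 : AtLeast1 (+ 2 * (B * y - x) - B * y)
      t≥1 = atLeast1-cancel A _ A≥1
              (nonNeg-≡ certificate (nonNeg-ℕ 2 ⟨*⟩ h ⟨+⟩ AB≥4 ⟨*⟩ y≥0 ⟨+⟩ nonNeg-ℕ 1))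
      moved : B * y - x ≡ (+ 2 * (B * y - x) - B * y - 1ℤ) + x + 1ℤ
      moved = solve (B ∷ x ∷ y ∷ [])
    cone-step (suc zero) (x , y) (x≥0 , y≥0 , h) = x≥0 , nonNeg-≡ moved (t≥1 ⟨+⟩ y≥0 ⟨+⟩ nonNeg-ℕ 1) , t≥1
      where
      certificate : B * (+ 2 * (A * x - y) - A * x) - 1ℤ
                  ≡ + 2 * (+ 2 * x - B * y - 1ℤ) + (A * B - + 4) * x + 1ℤ
      certificate = solve (A ∷ B ∷ x ∷ y ∷ [])
      t≥1 : AtLeast1 (+ 2 * (A * x - y) - A * x)
      t≥1 = atLeast1-cancel B _ B≥1
              (nonNeg-≡ certificate (nonNeg-ℕ 2 ⟨*⟩ h ⟨+⟩ AB≥4 ⟨*⟩ x≥0 ⟨+⟩ nonNeg-ℕ 1))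
      moved : A * x - y ≡ (+ 2 * (A * x - y) - A * x - 1ℤ) + y + 1ℤ
      moved = solve (A ∷ x ∷ y ∷ [])

    -- Propagating steepness back through one reflection: either w_e α is
    -- still positive and steep for the other index, or w_e already makes
    -- α negative, which forces α to be steep directly.
    steep-step : ∀ e α → Positive α → (Positive (s e α) → Steep (other e) (s e α)) → Steep e α
    steep-step zero (x , y) (x≥0 , y≥0 , α≢0) ih with 0ℤ ≤? B * y - x
    ... | yes x'≥0 = atLeast1-cancel A _ A≥1 (nonNeg-≡ certificate
                       (nonNeg-ℕ 2 ⟨*⟩ t≥1 ⟨+⟩ AB≥4 ⟨*⟩ y≥0 ⟨+⟩ nonNeg-ℕ 1))
                   , subst AtLeast1 (Q-invariant zero (x , y)) q≥1
      where
      certificate : A * (+ 2 * x - B * y) - 1ℤ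
                  ≡ + 2 * (+ 2 * y - A * (B * y - x) - 1ℤ) + (A * B - + 4) * y + 1ℤ
      certificate = solve (A ∷ B ∷ x ∷ y ∷ [])
      steep : Steep (suc zero) (s zero (x , y))
      steep = ih (x'≥0 , y≥0 , s-nonzero zero (x , y) α≢0)
      t≥1 : AtLeast1 (+ 2 * y - A * (B * y - x))
      t≥1 = proj₁ steep
      q≥1 : AtLeast1 (Q (s zero (x , y)))
      q≥1 = proj₂ steep
    ... | no x'≱0 = nonNeg-≡ pairing-certificate (m≥0 ⟨+⟩ x≥0)
                  , nonNeg-≡ Q-certificate
                      (A≥0 ⟨*⟩ (m≥0 ⟨+⟩ B≥0 ⟨*⟩ y≥0) ⟨*⟩ (m≥0 ⟨+⟩ nonNeg-ℕ 1)
                       ⟨+⟩ A≥0 ⟨*⟩ m≥0 ⟨+⟩ A≥1 ⟨+⟩ B≥0 ⟨*⟩ y≥0 ⟨*⟩ y≥0)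
      where
      m≥0 : NonNeg (- (B * y - x) - 1ℤ)
      m≥0 = below-zero _ x'≱0
      pairing-certificate : let m = - (B * y - x) - 1ℤ in + 2 * x - B * y - 1ℤ ≡ m + x
      pairing-certificate = solve (B ∷ x ∷ y ∷ [])
      Q-certificate : let m = - (B * y - x) - 1ℤ in
        A * x * x - A * B * x * y + B * y * y - 1ℤ
          ≡ A * (m + B * y) * (m + 1ℤ) + A * m + (A - 1ℤ) + B * y * y
      Q-certificate = solve (A ∷ B ∷ x ∷ y ∷ [])
    steep-step (suc zero) (x , y) (x≥0 , y≥0 , α≢0) ih with 0ℤ ≤? A * x - y
    ... | yes y'≥0 = atLeast1-cancel B _ B≥1 (nonNeg-≡ certificate
                       (nonNeg-ℕ 2 ⟨*⟩ t≥1 ⟨+⟩ AB≥4 ⟨*⟩ x≥0 ⟨+⟩ nonNeg-ℕ 1))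
                   , subst AtLeast1 (Q-invariant (suc zero) (x , y)) q≥1
      where
      certificate : B * (+ 2 * y - A * x) - 1ℤ
                  ≡ + 2 * (+ 2 * x - B * (A * x - y) - 1ℤ) + (A * B - + 4) * x + 1ℤ
      certificate = solve (A ∷ B ∷ x ∷ y ∷ [])
      steep : Steep zero (s (suc zero) (x , y))
      steep = ih (x≥0 , y'≥0 , s-nonzero (suc zero) (x , y) α≢0)
      t≥1 : AtLeast1 (+ 2 * x - B * (A * x - y))
      t≥1 = proj₁ steep
      q≥1 : AtLeast1 (Q (s (suc zero) (x , y)))
      q≥1 = proj₂ steep
    ... | no y'≱0 = nonNeg-≡ pairing-certificate (m≥0 ⟨+⟩ y≥0)
                  , nonNeg-≡ Q-certificate
                      (B≥0 ⟨*⟩ (m≥0 ⟨+⟩ A≥0 ⟨*⟩ x≥0) ⟨*⟩ (m≥0 ⟨+⟩ nonNeg-ℕ 1)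
                       ⟨+⟩ B≥0 ⟨*⟩ m≥0 ⟨+⟩ B≥1 ⟨+⟩ A≥0 ⟨*⟩ x≥0 ⟨*⟩ x≥0)
      where
      m≥0 : NonNeg (- (A * x - y) - 1ℤ)
      m≥0 = below-zero _ y'≱0
      pairing-certificate : let m = - (A * x - y) - 1ℤ in + 2 * y - A * x - 1ℤ ≡ m + y
      pairing-certificate = solve (A ∷ x ∷ y ∷ [])
      Q-certificate : let m = - (A * x - y) - 1ℤ in
        A * x * x - A * B * x * y + B * y * y - 1ℤ
          ≡ B * (m + A * x) * (m + 1ℤ) + B * m + (B - 1ℤ) + A * x * x
      Q-certificate = solve (A ∷ B ∷ x ∷ y ∷ [])

    steep-gap : ∀ β α → Positive α → Steep (other β) α →
      AtLeast1 (Q (α ⊖ simple β) - A) × AtLeast1 (Q (α ⊖ simple β) - B)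
    steep-gap zero (x , y) (x≥0 , y≥0 , _) (h , q≥1) =
      nonNeg-≡ A-certificate (q≥1 ⟨+⟩ A≥0 ⟨*⟩ u≥1 ⟨+⟩ A≥0) ,
      atLeast1-cancel (+ 2) (Q ((x , y) ⊖ simple zero) - B) (nonNeg-ℕ 1) (nonNeg-≡ B-certificate
        (nonNeg-ℕ 2 ⟨*⟩ q≥1 ⟨+⟩ A≥0 ⟨*⟩ B≥0 ⟨*⟩ h ⟨+⟩ A≥0 ⟨*⟩ x≥0 ⟨*⟩ AB≥4
         ⟨+⟩ B≥0 ⟨*⟩ A≥2 ⟨+⟩ nonNeg-ℕ 2 ⟨*⟩ A≥0 ⟨+⟩ nonNeg-ℕ 1))
      where
      u-certificate : + 2 * (B * y - + 2 * x) - 1ℤ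
                    ≡ B * (+ 2 * y - A * x - 1ℤ) + (A * B - + 4) * x + (B - + 2) + 1ℤ
      u-certificate = solve (A ∷ B ∷ x ∷ y ∷ [])
      u≥1 : AtLeast1 (B * y - + 2 * x)
      u≥1 = atLeast1-cancel (+ 2) (B * y - + 2 * x) (nonNeg-ℕ 1) (nonNeg-≡ u-certificate
              (B≥0 ⟨*⟩ h ⟨+⟩ AB≥4 ⟨*⟩ x≥0 ⟨+⟩ B≥2 ⟨+⟩ nonNeg-ℕ 1))
      A-certificate : let x' = x - 1ℤ ; y' = y - 0ℤ in
        A * x' * x' - A * B * x' * y' + B * y' * y' - A - 1ℤ
          ≡ (A * x * x - A * B * x * y + B * y * y - 1ℤ) + A * (B * y - + 2 * x - 1ℤ) + A
      A-certificate = solve (A ∷ B ∷ x ∷ y ∷ [])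
      B-certificate : let x' = x - 1ℤ ; y' = y - 0ℤ in
        + 2 * (A * x' * x' - A * B * x' * y' + B * y' * y' - B) - 1ℤ
          ≡ + 2 * (A * x * x - A * B * x * y + B * y * y - 1ℤ) + A * B * (+ 2 * y - A * x - 1ℤ)
            + A * x * (A * B - + 4) + B * (A - + 2) + + 2 * A + 1ℤ
      B-certificate = solve (A ∷ B ∷ x ∷ y ∷ [])
    steep-gap (suc zero) (x , y) (x≥0 , y≥0 , _) (h , q≥1) =
      atLeast1-cancel (+ 2) (Q ((x , y) ⊖ simple (suc zero)) - A) (nonNeg-ℕ 1) (nonNeg-≡ A-certificate
        (nonNeg-ℕ 2 ⟨*⟩ q≥1 ⟨+⟩ A≥0 ⟨*⟩ B≥0 ⟨*⟩ h ⟨+⟩ B≥0 ⟨*⟩ y≥0 ⟨*⟩ AB≥4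
         ⟨+⟩ A≥0 ⟨*⟩ B≥2 ⟨+⟩ nonNeg-ℕ 2 ⟨*⟩ B≥0 ⟨+⟩ nonNeg-ℕ 1)) ,
      nonNeg-≡ B-certificate (q≥1 ⟨+⟩ B≥0 ⟨*⟩ u≥1 ⟨+⟩ B≥0)
      where
      u-certificate : + 2 * (A * x - + 2 * y) - 1ℤ
                    ≡ A * (+ 2 * x - B * y - 1ℤ) + (A * B - + 4) * y + (A - + 2) + 1ℤ
      u-certificate = solve (A ∷ B ∷ x ∷ y ∷ [])
      u≥1 : AtLeast1 (A * x - + 2 * y)
      u≥1 = atLeast1-cancel (+ 2) (A * x - + 2 * y) (nonNeg-ℕ 1) (nonNeg-≡ u-certificate
              (A≥0 ⟨*⟩ h ⟨+⟩ AB≥4 ⟨*⟩ y≥0 ⟨+⟩ A≥2 ⟨+⟩ nonNeg-ℕ 1))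
      A-certificate : let x' = x - 0ℤ ; y' = y - 1ℤ in
        + 2 * (A * x' * x' - A * B * x' * y' + B * y' * y' - A) - 1ℤ
          ≡ + 2 * (A * x * x - A * B * x * y + B * y * y - 1ℤ) + A * B * (+ 2 * x - B * y - 1ℤ)
            + B * y * (A * B - + 4) + A * (B - + 2) + + 2 * B + 1ℤ
      A-certificate = solve (A ∷ B ∷ x ∷ y ∷ [])
      B-certificate : let x' = x - 0ℤ ; y' = y - 1ℤ in
        A * x' * x' - A * B * x' * y' + B * y' * y' - B - 1ℤ
          ≡ (A * x * x - A * B * x * y + B * y * y - 1ℤ) + B * (A * x - + 2 * y - 1ℤ) + B
      B-certificate = solve (A ∷ B ∷ x ∷ y ∷ [])

module Weyl (a b : ℕ) (2≤a : 2 ℕ.≤ a) (2≤b : 2 ℕ.≤ b) where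

  open Rank2 (+ a) (+ b)
  open Bounds (nonNeg-from-ℕ a 2≤a) (nonNeg-from-ℕ b 2≤b)

  _≈_ : Word → Word → Set
  u ≈ u' = u ≈W[ a , b ] u'

  reflection≡s : ∀ i γ → Defs.refl a b i γ ≡ s i γ
  reflection≡s zero (x , y) = cong₂ _,_ (moved (+ b) x y) (fixed (+ b) x y)
    where
    moved : ∀ k x y → x - (x * + 2 + y * - k) * 1ℤ ≡ k * y - x
    moved = solve-∀
    fixed : ∀ k x y → y - (x * + 2 + y * - k) * 0ℤ ≡ y
    fixed = solve-∀
  reflection≡s (suc zero) (x , y) = cong₂ _,_ (fixed (+ a) x y) (moved (+ a) x y)
    where
    fixed : ∀ k x y → x - (x * - k + y * + 2) * 0ℤ ≡ x
    fixed = solve-∀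
    moved : ∀ k x y → y - (x * - k + y * + 2) * 1ℤ ≡ k * x - y
    moved = solve-∀

  reflection-involutive : ∀ i γ → Defs.refl a b i (Defs.refl a b i γ) ≡ γ
  reflection-involutive i γ = begin
    Defs.refl a b i (Defs.refl a b i γ)   ≡⟨ reflection≡s i _ ⟩
    s i (Defs.refl a b i γ)               ≡⟨ cong (s i) (reflection≡s i γ) ⟩
    s i (s i γ)                           ≡⟨ s-involutive i γ ⟩
    γ                                     ∎
    where open ≡-Reasoning

  act-cons : ∀ i u γ → act a b (i ∷ u) γ ≡ s i (act a b u γ)
  act-cons i u γ = reflection≡s i (act a b u γ)

  act-++ : ∀ u v γ → act a b (u ++ v) γ ≡ act a b u (act a b v γ)
  act-++ [] v γ = refl
  act-++ (i ∷ u) v γ = cong (Defs.refl a b i) (act-++ u v γ)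

  act-snoc : ∀ u e γ → act a b (u ++ e ∷ []) γ ≡ act a b u (s e γ)
  act-snoc u e γ = trans (act-++ u (e ∷ []) γ) (cong (act a b u) (reflection≡s e γ))

  act-alt-snoc : ∀ j n γ → act a b (alt j (suc n)) γ ≡ act a b (alt j n) (s (letter j n) γ)
  act-alt-snoc j n γ = trans (cong (λ u → act a b u γ) (alt-snoc j n)) (act-snoc (alt j n) (letter j n) γ)

  act-neg : ∀ u γ → act a b u (neg γ) ≡ neg (act a b u γ)
  act-neg [] γ = refl
  act-neg (i ∷ u) γ = begin
    act a b (i ∷ u) (neg γ)    ≡⟨ act-cons i u (neg γ) ⟩
    s i (act a b u (neg γ))    ≡⟨ cong (s i) (act-neg u γ) ⟩
    s i (neg (act a b u γ))    ≡⟨ s-neg i (act a b u γ) ⟩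
    neg (s i (act a b u γ))    ≡⟨ cong neg (sym (act-cons i u γ)) ⟩
    neg (act a b (i ∷ u) γ)    ∎
    where open ≡-Reasoning

  act-Q : ∀ u γ → Q (act a b u γ) ≡ Q γ
  act-Q [] γ = refl
  act-Q (i ∷ u) γ = begin
    Q (act a b (i ∷ u) γ)   ≡⟨ cong Q (act-cons i u γ) ⟩
    Q (s i (act a b u γ))   ≡⟨ Q-invariant i (act a b u γ) ⟩
    Q (act a b u γ)         ≡⟨ act-Q u γ ⟩
    Q γ                     ∎
    where open ≡-Reasoning

  real-root-norm : ∀ δ → RealRoot a b δ → Q δ ≡ + a ⊎ Q δ ≡ + b
  real-root-norm δ (u , i , refl) with Q-simple i
  ... | inj₁ Q≡A = inj₁ (trans (act-Q u (simple i)) Q≡A)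
  ... | inj₂ Q≡B = inj₂ (trans (act-Q u (simple i)) Q≡B)

  act-prepend : ∀ j p γ → act a b (j ∷ uncurry alt p) γ ≡ act a b (uncurry alt (prepend j p)) γ
  act-prepend j (i , zero) γ = refl
  act-prepend zero (zero , suc m) γ = reflection-involutive zero (act a b (alt (suc zero) m) γ)
  act-prepend zero (suc zero , suc m) γ = refl
  act-prepend (suc zero) (zero , suc m) γ = refl
  act-prepend (suc zero) (suc zero , suc m) γ = reflection-involutive (suc zero) (act a b (alt zero m) γ)

  act-normal : ∀ w → w ≈ uncurry alt (normal w)
  act-normal [] γ = refl
  act-normal (j ∷ u) γ = trans (cong (Defs.refl a b j) (act-normal u γ)) (act-prepend j (normal u) γ)

  cancel-right : ∀ u u' e → (∀ γ → act a b u (s e γ) ≡ act a b u' (s e γ)) → u ≈ u'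
  cancel-right u u' e h γ = begin
    act a b u γ               ≡⟨ cong (act a b u) (sym (s-involutive e γ)) ⟩
    act a b u (s e (s e γ))   ≡⟨ h (s e γ) ⟩
    act a b u' (s e (s e γ))  ≡⟨ cong (act a b u') (s-involutive e γ) ⟩
    act a b u' γ              ∎
    where open ≡-Reasoning

  cone-alt : ∀ j n α → Cone (letter j n) α → Cone j (act a b (alt j n) α)
  cone-alt j zero α h = h
  cone-alt j (suc n) α h =
    subst (Cone j) (sym (act-cons j (alt (other j) n) α)) (cone-step j _ (cone-alt (other j) n α h))

  alt-inverts-last : ∀ j n → Negative (act a b (alt j (suc n)) (simple (letter j n)))
  alt-inverts-last j n =
    subst Negative (sym image) (positive⇒negative-neg _ (cone-positive j _ in-cone))
    where
    σ : Lat
    σ = simple (letter j n)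
    in-cone : Cone j (act a b (alt j n) σ)
    in-cone = cone-alt j n σ (cone-simple (letter j n))
    image : act a b (alt j (suc n)) σ ≡ neg (act a b (alt j n) σ)
    image = begin
      act a b (alt j (suc n)) σ           ≡⟨ act-alt-snoc j n σ ⟩
      act a b (alt j n) (s (letter j n) σ) ≡⟨ cong (act a b (alt j n)) (s-simple (letter j n)) ⟩
      act a b (alt j n) (neg σ)           ≡⟨ act-neg (alt j n) σ ⟩
      neg (act a b (alt j n) σ)           ∎
      where open ≡-Reasoning

  -- Compare the last letters: equal ones cancel, and if they
  -- differ alt i n keeps the simple root inverted by alt j m positive.
  alt-minimal : ∀ m j n i → alt i n ≈ alt j m → m ℕ.≤ n
  alt-minimal zero j n i _ = z≤n
  alt-minimal (suc m) j zero i h = ⊥-elim $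
    positive-not-negative σ (cone-positive (letter j m) σ (cone-simple (letter j m)))
      (subst Negative (sym (h σ)) (alt-inverts-last j m))
    where
    σ : Lat
    σ = simple (letter j m)
  alt-minimal (suc m) j (suc n) i h with same-or-other (letter i n) (letter j m)
  ... | inj₁ same = s≤s (alt-minimal m j n i (cancel-right (alt i n) (alt j m) (letter j m) shorter))
    where
    shorter : ∀ γ → act a b (alt i n) (s (letter j m) γ) ≡ act a b (alt j m) (s (letter j m) γ)
    shorter γ = begin
      act a b (alt i n) (s (letter j m) γ)  ≡⟨ cong (λ e → act a b (alt i n) (s e γ)) (sym same) ⟩
      act a b (alt i n) (s (letter i n) γ)  ≡⟨ sym (act-alt-snoc i n γ) ⟩
      act a b (alt i (suc n)) γ             ≡⟨ h γ ⟩
      act a b (alt j (suc m)) γ             ≡⟨ act-alt-snoc j m γ ⟩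
      act a b (alt j m) (s (letter j m) γ)  ∎
      where open ≡-Reasoning
  ... | inj₂ differ = ⊥-elim $ positive-not-negative _ (cone-positive i _ (cone-alt i (suc n) σ in-cone))
                        (subst Negative (sym (h σ)) (alt-inverts-last j m))
    where
    σ : Lat
    σ = simple (letter j m)
    in-cone : Cone (letter i (suc n)) σ
    in-cone = subst (λ e → Cone e σ) (sym (trans (letter-other n i) (sym differ))) (cone-simple (letter j m))

  alt-shortest : ∀ w i n → w ≈ alt i n → n ℕ.≤ length w
  alt-shortest w i n w≈alt = ℕP.≤-trans
    (alt-minimal n i (proj₂ (normal w)) (proj₁ (normal w)) (λ γ → trans (sym (act-normal w γ)) (w≈alt γ)))
    (normal-length w)

  inverted-steep : ∀ j n α → Positive α → Negative (act a b (alt j n) α) → Steep (other (letter j n)) α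
  inverted-steep j zero α α>0 α<0 = ⊥-elim (positive-not-negative α α>0 α<0)
  inverted-steep j (suc n) α α>0 vα<0 =
    subst (λ e → Steep e α) (sym (other-letter-suc j n)) (steep-step (letter j n) α α>0 reflected)
    where
    reflected : Positive (s (letter j n) α) → Steep (other (letter j n)) (s (letter j n) α)
    reflected sα>0 = inverted-steep j n _ sα>0 (subst Negative (act-alt-snoc j n α) vα<0)

  steep-not-real : ∀ β α → Positive α → Steep (other β) α → ¬ RealRoot a b (α ⊖ simple β)
  steep-not-real β α α>0 steep real =
    norm-gap (α ⊖ simple β) (proj₁ gap) (proj₂ gap) (real-root-norm (α ⊖ simple β) real)
    where
    gap : AtLeast1 (Q (α ⊖ simple β) - + a) × AtLeast1 (Q (α ⊖ simple β) - + b)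
    gap = steep-gap β α α>0 steep

proposition4p4 : (a b : ℕ) → 2 ℕ.≤ a → 2 ℕ.≤ b → 5 ℕ.≤ a ℕ.* b →
    (w : Word) → ¬ (w ≈W[ a , b ] []) →
    Σ Word λ v → Σ (Fin 2) λ β →
    (w ≈W[ a , b ] (v ++ (β ∷ []))) × LengthLess a b v w ×
    (∀ α → InvSet a b v α → ¬ RealRoot a b (α ⊖ simple β))
proposition4p4 a b 2≤a 2≤b _ w w≉1 = exchange (normal w) (act-normal w)
  where
  open Weyl a b 2≤a 2≤b
  -- w = alt i (suc k) = alt i k · w_β with β = letter i k
  exchange : ∀ p → w ≈ uncurry alt p →
    Σ Word λ v → Σ (Fin 2) λ β →
    (w ≈ (v ++ (β ∷ []))) × LengthLess a b v w ×
    (∀ α → InvSet a b v α → ¬ RealRoot a b (α ⊖ simple β))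
  exchange (i , zero) w≈1 = ⊥-elim (w≉1 w≈1)
  exchange (i , suc k) w≈alt = alt i k , letter i k , factorisation , (alt i k , (λ _ → refl) , shorter) , no-real
    where
    factorisation : w ≈ (alt i k ++ letter i k ∷ [])
    factorisation γ = trans (w≈alt γ) (cong (λ u → act a b u γ) (alt-snoc i k))
    shorter : ∀ w' → w' ≈ w → length (alt i k) ℕ.< length w'
    shorter w' w'≈w = subst (ℕ._< length w') (sym (length-alt i k))
      (alt-shortest w' i (suc k) (λ γ → trans (w'≈w γ) (w≈alt γ)))
    no-real : ∀ α → InvSet a b (alt i k) α → ¬ RealRoot a b (α ⊖ simple (letter i k))
    no-real α (_ , α>0 , _ , vα<0) = steep-not-real (letter i k) α α>0 (inverted-steep i k α α>0 vα<0)
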